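{- Let $n=2^m+1$ where $m=2^{\alpha}m_1$ with $\alpha\ge 0$ an integer and $m_1>1$ an odd integer. If $2^{2^{\alpha}}+1$ is not prime, then $n\in\mathfrak{P}$.
   Context: For an odd positive integer $n$, put $G(n)=\sum_{j=1}^{n-1} j^{(n-1)/2}$. Let $\mathfrak{P}$ denote the set of odd positive integers $n$ such that $G(n)\equiv 0\pmod n$. -}

module Defs where

open import Data.Nat using (ℕ; zero; suc; _+_; _*_; _∸_; _^_; _/_)
open import Data.Nat.Divisibility using (_∣_)
open import Data.Product using (_×_; ∃)
open import Relation.Binary.PropositionalEquality using (_≡_)

Odd : ℕ → Set
Odd n = ∃ λ k → n ≡ 2 * k + 1

sumFrom1 : ℕ → (ℕ → ℕ) → ℕ
sumFrom1 zero    f = 0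
sumFrom1 (suc k) f = sumFrom1 k f + f (suc k)

G : ℕ → ℕ
G n = sumFrom1 (n ∸ 1) (λ j → j ^ ((n ∸ 1) / 2))

-- membership in 𝔓: n an odd positive integer with G(n) ≡ 0 (mod n)
-- (odd already implies positive)
InP : ℕ → Set
InP n = Odd n × (n ∣ G n)

module Submission where

-- With K = (n − 1) / 2 = 2 ^ (m − 1) we have G n = Σ_{j<n} j ^ K (as 0 ^ K = 0),
-- and it suffices that every prime power q = p ^ a dividing n divides this sum.
-- Modulo q the sum is (n / q) copies of X = Σ_{j<q} j ^ K, and if some c prime
-- to p has p ∤ c ^ K − 1, multiplying the residues by c permutes them, so
-- (c ^ K − 1) X ≡ 0 and q ∣ X. Such a c exists whenever p − 1 ∤ 2 ^ (m − 1):
-- otherwise Fermat's little theorem and Bézout make every unit a root of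
-- x ^ (2 ^ s) ≡ 1 with 2 ^ s < p − 1, while squaring shows that this congruence
-- has at most 2 ^ s roots. Finally, a prime p ∣ 2 ^ m + 1 with p − 1 a power of 2
-- is 2 ^ s + 1 with s an odd multiple of 2 ^ α, so 2 ^ (2 ^ α) + 1 divides it,
-- contradicting the hypothesis.

open import Defs
open import Data.Nat using (ℕ; _+_; _*_; _^_; _<_)
open import Data.Nat.Primality using (Prime)
open import Relation.Nullary using (¬_)
open import Data.Nat
open import Data.Nat.Properties
open import Data.Nat.DivMod
open import Data.Nat.Divisibility
open import Data.Nat.Induction using (<-rec)
open import Data.Nat.Coprimality using (Coprime; coprime-divisor; coprime-Bézout)
import Data.Nat.Coprimality as Coprime
open import Data.Nat.GCD using (module Bézout; module GCD)
open import Data.Nat.Primality using (euclidsLemma; prime⇒irreducible; prime⇒nonZero; prime⇒nonTrivial; prime[2]; ¬prime[1])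
open import Data.Nat.Primality.Factorisation using (factorise)
open import Data.Nat.Solver using (module +-*-Solver)
open import Data.Fin using (Fin; toℕ; fromℕ<)
open import Data.Fin.Properties using (toℕ-fromℕ<; toℕ-injective; toℕ<n; any?; ¬∀⟶∃¬)
open import Data.Fin.Permutation using (Permutation; permutation)
open import Data.List.Base using ([]; _∷_)
open import Data.List.Relation.Unary.All using (_∷_)
open import Data.Product using (∃; ∃₂; _×_; _,_; proj₂)
open import Data.Sum using (_⊎_; inj₁; inj₂)
open import Algebra.Bundles using (CommutativeMonoid)
import Algebra.Properties.CommutativeMonoid.Sum as MonoidSum
import Algebra.Properties.Semiring.Sum as SemiringSum
open import Relation.Nullary using (yes; no; contradiction)
open import Relation.Nullary.Decidable using (_⊎-dec_)
open import Relation.Binary.PropositionalEquality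
open import Function using (_∘′_)

open +-*-Solver using (solve; _:*_; _:+_; _:=_; con)

*-interchange : ∀ a b c d → a * b * (c * d) ≡ a * c * (b * d)
*-interchange = solve 4 (λ a b c d → a :* b :* (c :* d) := a :* c :* (b :* d)) refl

^-distribʳ-* : ∀ a b k → (a * b) ^ k ≡ a ^ k * b ^ k
^-distribʳ-* a b zero    = refl
^-distribʳ-* a b (suc k) = trans (cong (a * b *_) (^-distribʳ-* a b k)) (*-interchange a b (a ^ k) (b ^ k))

∣∧<⇒≡0 : ∀ {d x} → d ∣ x → x < d → x ≡ 0
∣∧<⇒≡0     (divides zero    refl) _   = refl
∣∧<⇒≡0 {d} (divides (suc k) refl) x<d = contradiction x<d (≤⇒≯ (m≤m+n d (k * d)))

module _ {q : ℕ} .{{_ : NonZero q}} where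

  %-cong-+ : ∀ {a a′ b b′} → a % q ≡ a′ % q → b % q ≡ b′ % q → (a + b) % q ≡ (a′ + b′) % q
  %-cong-+ {a} {a′} {b} {b′} a≡a′ b≡b′ = begin
    (a + b) % q             ≡⟨ %-distribˡ-+ a b q ⟩
    (a % q + b % q) % q     ≡⟨ cong₂ (λ x y → (x + y) % q) a≡a′ b≡b′ ⟩
    (a′ % q + b′ % q) % q   ≡⟨ %-distribˡ-+ a′ b′ q ⟨
    (a′ + b′) % q           ∎
    where open ≡-Reasoning

  %-cong-* : ∀ {a a′ b b′} → a % q ≡ a′ % q → b % q ≡ b′ % q → (a * b) % q ≡ (a′ * b′) % q
  %-cong-* {a} {a′} {b} {b′} a≡a′ b≡b′ = begin
    (a * b) % q             ≡⟨ %-distribˡ-* a b q ⟩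
    (a % q * (b % q)) % q   ≡⟨ cong₂ (λ x y → (x * y) % q) a≡a′ b≡b′ ⟩
    (a′ % q * (b′ % q)) % q ≡⟨ %-distribˡ-* a′ b′ q ⟨
    (a′ * b′) % q           ∎
    where open ≡-Reasoning

  %-cong-^ : ∀ {a a′} e → a % q ≡ a′ % q → (a ^ e) % q ≡ (a′ ^ e) % q
  %-cong-^ zero    _     = refl
  %-cong-^ (suc e) a≡a′ = %-cong-* a≡a′ (%-cong-^ e a≡a′)

  ^-one : ∀ {a} e → a % q ≡ 1 % q → (a ^ e) % q ≡ 1 % q
  ^-one {a} e a≡1 = trans (%-cong-^ e a≡1) (cong (_% q) (^-zeroˡ e))

  %≡⇒∣∸ : ∀ {a b} → b ≤ a → a % q ≡ b % q → q ∣ a ∸ b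
  %≡⇒∣∸ {a} {b} b≤a a≡b = divides (a / q ∸ b / q) (begin
    a ∸ b                                     ≡⟨ cong₂ _∸_ (m≡m%n+[m/n]*n a q) (m≡m%n+[m/n]*n b q) ⟩
    (a % q + a / q * q) ∸ (b % q + b / q * q) ≡⟨ cong (λ x → (x + a / q * q) ∸ (b % q + b / q * q)) a≡b ⟩
    (b % q + a / q * q) ∸ (b % q + b / q * q) ≡⟨ [m+n]∸[m+o]≡n∸o (b % q) (a / q * q) (b / q * q) ⟩
    a / q * q ∸ b / q * q                     ≡⟨ *-distribʳ-∸ q (a / q) (b / q) ⟨
    (a / q ∸ b / q) * q                       ∎)
    where open ≡-Reasoning

  ∣∸⇒%≡ : ∀ {a b} → b ≤ a → q ∣ a ∸ b → a % q ≡ b % q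
  ∣∸⇒%≡ {a} {b} b≤a (divides t a∸b≡tq) = begin
    a % q           ≡⟨ cong (_% q) (m∸n+n≡m b≤a) ⟨
    (a ∸ b + b) % q ≡⟨ cong (λ x → (x + b) % q) a∸b≡tq ⟩
    (t * q + b) % q ≡⟨ cong (_% q) (+-comm (t * q) b) ⟩
    (b + t * q) % q ≡⟨ [m+kn]%n≡m%n b t q ⟩
    b % q           ∎
    where open ≡-Reasoning

  -- If multiplication by a ≥ 1 fixes y modulo q, then q divides (a ∸ 1) * y.
  -- This is the common core of Fermat's little theorem and of the vanishing
  -- of power sums below.
  fixed⇒∣ : ∀ {a y} → 1 ≤ a → (a * y) % q ≡ y % q → q ∣ (a ∸ 1) * y
  fixed⇒∣ {a} {y} 1≤a ay≡y = subst (q ∣_) (begin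
    a * y ∸ y     ≡⟨ cong (a * y ∸_) (*-identityˡ y) ⟨
    a * y ∸ 1 * y ≡⟨ *-distribʳ-∸ y a 1 ⟨
    (a ∸ 1) * y   ∎) (%≡⇒∣∸ y≤ay ay≡y)
    where
    open ≡-Reasoning
    y≤ay : y ≤ a * y
    y≤ay = subst (_≤ a * y) (*-identityˡ y) (*-monoˡ-≤ y 1≤a)

prime∤⇒coprime : ∀ {p a} → Prime p → ¬ p ∣ a → Coprime p a
prime∤⇒coprime pp p∤a {d} (d∣p , d∣a) with prime⇒irreducible pp d∣p
... | inj₁ d≡1 = d≡1
... | inj₂ refl = contradiction d∣a p∤a

coprime-* : ∀ {a m n} → Coprime a m → Coprime a n → Coprime a (m * n)
coprime-* {a} {m} {n} a⊥m a⊥n {d} (d∣a , d∣mn) = a⊥n (d∣a , coprime-divisor d⊥m d∣mn)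
  where
  d⊥m : Coprime d m
  d⊥m (e∣d , e∣m) = a⊥m (∣-trans e∣d d∣a , e∣m)

coprime-^ : ∀ {a m} e → Coprime a m → Coprime a (m ^ e)
coprime-^ zero    _   (_ , d∣1) = ∣1⇒≡1 d∣1
coprime-^ (suc e) a⊥m = coprime-* a⊥m (coprime-^ e a⊥m)

inverse : ∀ q .{{_ : NonZero q}} c → Coprime c q → ∃ λ u → (c * u) % q ≡ 1 % q
inverse q@(suc q-1) c c⊥q with coprime-Bézout c⊥q
... | Bézout.+- x y 1+yq≡xc = x , (begin
    (c * x) % q      ≡⟨ cong (_% q) (trans (*-comm c x) (sym 1+yq≡xc)) ⟩
    (1 + y * q) % q  ≡⟨ [m+kn]%n≡m%n 1 y q ⟩
    1 % q            ∎)
  where open ≡-Reasoning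
... | Bézout.-+ x y 1+xc≡yq = x * q-1 , (begin
    (c * (x * q-1)) % q                  ≡⟨ %-remove-+ʳ (c * (x * q-1)) q∣1+xc ⟨
    (c * (x * q-1) + (1 + x * c)) % q    ≡⟨ cong (_% q) (rearrange c x q-1) ⟩
    (1 + c * x * q) % q                  ≡⟨ [m+kn]%n≡m%n 1 (c * x) q ⟩
    1 % q                                ∎)
  where
  open ≡-Reasoning
  q∣1+xc : q ∣ 1 + x * c
  q∣1+xc = divides y 1+xc≡yq
  rearrange : ∀ c x q-1 → c * (x * q-1) + (1 + x * c) ≡ 1 + c * x * suc q-1
  rearrange = solve 3 (λ c x q-1 → c :* (x :* q-1) :+ (con 1 :+ x :* c) := con 1 :+ c :* x :* (con 1 :+ q-1)) refl

0<a<p⇒∤ : ∀ {p a} → 0 < a → a < p → ¬ p ∣ a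
0<a<p⇒∤ {a = suc _} _ a<p p∣a = <⇒≱ a<p (∣⇒≤ p∣a)

∤⇒>0 : ∀ {p a} → ¬ p ∣ a → 0 < a
∤⇒>0 {a = zero}  p∤0 = contradiction (_ ∣0) p∤0
∤⇒>0 {a = suc _} _   = z<s

^-positive : ∀ {c} e → 0 < c → 0 < c ^ e
^-positive {c} e c>0 = m^n>0 c {{>-nonZero c>0}} e

module _ (q : ℕ) .{{_ : NonZero q}} where

  _·_ : ℕ → Fin q → Fin q
  c · i = fromℕ< (m%n<n (c * toℕ i) q)

  ·-inverse : ∀ c u → (c * u) % q ≡ 1 % q → ∀ i → u · (c · i) ≡ i
  ·-inverse c u cu≡1 i = toℕ-injective (begin
    toℕ (u · (c · i))            ≡⟨ toℕ-fromℕ< _ ⟩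
    (u * toℕ (c · i)) % q        ≡⟨ cong (λ x → (u * x) % q) (toℕ-fromℕ< _) ⟩
    (u * ((c * toℕ i) % q)) % q  ≡⟨ %-cong-* {a = u} refl (m%n%n≡m%n (c * toℕ i) q) ⟩
    (u * (c * toℕ i)) % q        ≡⟨ cong (_% q) (*-assoc u c (toℕ i)) ⟨
    (u * c * toℕ i) % q          ≡⟨ %-cong-* {b = toℕ i} (trans (cong (_% q) (*-comm u c)) cu≡1) refl ⟩
    (1 * toℕ i) % q              ≡⟨ cong (_% q) (*-identityˡ (toℕ i)) ⟩
    toℕ i % q                    ≡⟨ m<n⇒m%n≡m (toℕ<n i) ⟩
    toℕ i                        ∎)
    where open ≡-Reasoning

  ·-permutation : ∀ c u → (c * u) % q ≡ 1 % q → Permutation q q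
  ·-permutation c u cu≡1 = permutation (c ·_) (u ·_)
    (·-inverse u c (trans (cong (_% q) (*-comm u c)) cu≡1)) (·-inverse c u cu≡1)

module _ {a ℓ} (M : CommutativeMonoid a ℓ) where
  open CommutativeMonoid M using (Carrier; _≈_) renaming (trans to ≈-trans; reflexive to ≈-reflexive)
  open MonoidSum M using (sum; sum-permute; sum-cong-≗)

  sum-unit-invariant : ∀ q .{{_ : NonZero q}} c u → (c * u) % q ≡ 1 % q → (f : ℕ → Carrier) →
    sum (λ (i : Fin q) → f (toℕ i)) ≈ sum (λ (i : Fin q) → f ((c * toℕ i) % q))
  sum-unit-invariant q c u cu≡1 f = ≈-trans (sum-permute (λ i → f (toℕ i)) (·-permutation q c u cu≡1))
    (≈-reflexive (sum-cong-≗ {q} (λ i → cong f (toℕ-fromℕ< (m%n<n (c * toℕ i) q)))))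

module Σ = SemiringSum +-*-semiring
module Π = MonoidSum *-1-commutativeMonoid

Σ< : ℕ → (ℕ → ℕ) → ℕ
Σ< N f = Σ.sum {N} (λ i → f (toℕ i))

Π< : ℕ → (ℕ → ℕ) → ℕ
Π< N f = Π.sum {N} (λ i → f (toℕ i))

Σ<-snoc : ∀ N f → Σ< (suc N) f ≡ Σ< N f + f N
Σ<-snoc zero    f = +-comm (f 0) 0
Σ<-snoc (suc N) f = trans (cong (f 0 +_) (Σ<-snoc N (λ j → f (suc j)))) (sym (+-assoc (f 0) _ _))

Σ<-split : ∀ a b f → Σ< (a + b) f ≡ Σ< a f + Σ< b (λ j → f (a + j))
Σ<-split zero    b f = refl
Σ<-split (suc a) b f = trans (cong (f 0 +_) (Σ<-split a b (λ j → f (suc j)))) (sym (+-assoc (f 0) _ _))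

Σ<-mono : ∀ N {f g} → (∀ j → j < N → f j ≤ g j) → Σ< N f ≤ Σ< N g
Σ<-mono zero    f≤g = z≤n
Σ<-mono (suc N) f≤g = +-mono-≤ (f≤g 0 z<s) (Σ<-mono N (λ j j<N → f≤g (suc j) (s<s j<N)))

Σ<-const : ∀ N c → Σ< N (λ _ → c) ≡ N * c
Σ<-const zero    c = refl
Σ<-const (suc N) c = cong (c +_) (Σ<-const N c)

module _ {q : ℕ} .{{_ : NonZero q}} where

  Σ<-cong-% : ∀ N f g → (∀ j → j < N → f j % q ≡ g j % q) → Σ< N f % q ≡ Σ< N g % q
  Σ<-cong-% zero    f g _   = refl
  Σ<-cong-% (suc N) f g f≡g = %-cong-+ (f≡g 0 z<s)
    (Σ<-cong-% N (λ j → f (suc j)) (λ j → g (suc j)) (λ j j<N → f≡g (suc j) (s<s j<N)))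

  Π<-cong-% : ∀ N f g → (∀ j → j < N → f j % q ≡ g j % q) → Π< N f % q ≡ Π< N g % q
  Π<-cong-% zero    f g _   = refl
  Π<-cong-% (suc N) f g f≡g = %-cong-* (f≡g 0 z<s)
    (Π<-cong-% N (λ j → f (suc j)) (λ j → g (suc j)) (λ j j<N → f≡g (suc j) (s<s j<N)))

  Σ<-periodic : ∀ b f → (∀ j → f (q + j) % q ≡ f j % q) → Σ< (b * q) f % q ≡ (b * Σ< q f) % q
  Σ<-periodic zero    f periodic = refl
  Σ<-periodic (suc b) f periodic = begin
    Σ< (q + b * q) f % q                             ≡⟨ cong (_% q) (Σ<-split q (b * q) f) ⟩
    (Σ< q f + Σ< (b * q) (λ j → f (q + j))) % q      ≡⟨ %-cong-+ {a = Σ< q f} refl shifted ⟩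
    (Σ< q f + b * Σ< q f) % q                        ∎
    where
    open ≡-Reasoning
    shifted : Σ< (b * q) (λ j → f (q + j)) % q ≡ (b * Σ< q f) % q
    shifted = trans (Σ<-cong-% (b * q) (λ j → f (q + j)) f (λ j _ → periodic j)) (Σ<-periodic b f periodic)

Π<-scale : ∀ N c h → Π< N (λ j → c * h j) ≡ c ^ N * Π< N h
Π<-scale zero    c h = refl
Π<-scale (suc N) c h = begin
  c * h 0 * Π< N (λ j → c * h (suc j))   ≡⟨ cong (c * h 0 *_) (Π<-scale N c (λ j → h (suc j))) ⟩
  c * h 0 * (c ^ N * Π< N (λ j → h (suc j))) ≡⟨ *-interchange c (h 0) (c ^ N) _ ⟩
  c * c ^ N * (h 0 * Π< N (λ j → h (suc j))) ∎
  where open ≡-Reasoning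

Π<-prime∤ : ∀ {p} → Prime p → ∀ N h → (∀ j → j < N → ¬ p ∣ h j) → ¬ p ∣ Π< N h
Π<-prime∤ pp zero    h _   p∣1 = ¬prime[1] (subst Prime (∣1⇒≡1 p∣1) pp)
Π<-prime∤ pp (suc N) h p∤h p∣Π with euclidsLemma (h 0) (Π< N (λ j → h (suc j))) pp p∣Π
... | inj₁ p∣h0 = p∤h 0 z<s p∣h0
... | inj₂ p∣Π′ = Π<-prime∤ pp N (λ j → h (suc j)) (λ j j<N → p∤h (suc j) (s<s j<N)) p∣Π′

-- Fermat's little theorem. Multiplication by c permutes the nonzero residues,
-- so c ^ (p ∸ 1) fixes their product (p ∸ 1)! modulo p, which p does not divide.
fermat : ∀ {p} .{{_ : NonZero p}} → Prime p → ∀ c → ¬ p ∣ c → (c ^ (p ∸ 1)) % p ≡ 1 % p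
fermat {p@(suc N)} pp c p∤c = ∣∸⇒%≡ cᴺ≥1 (coprime-divisor (prime∤⇒coprime pp p∤F) p∣F·[cᴺ∸1])
  where
  nonzero : ℕ → ℕ
  nonzero zero    = 1
  nonzero (suc x) = suc x

  nonzero-% : ∀ x → ¬ p ∣ x → nonzero (x % p) ≡ x % p
  nonzero-% x p∤x with x % p in x%p≡r
  ... | zero  = contradiction (m%n≡0⇒n∣m x p x%p≡r) p∤x
  ... | suc _ = refl

  c⁻¹ = inverse p c (Coprime.sym (prime∤⇒coprime pp p∤c))
  cᴺ≥1 = ^-positive N (∤⇒>0 p∤c)

  F = Π< N suc
  g : ℕ → ℕ
  g j = nonzero ((c * suc j) % p)

  p∤F : ¬ p ∣ F
  p∤F = Π<-prime∤ pp N suc (λ j j<N → 0<a<p⇒∤ z<s (s<s j<N))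

  p∤c·j : ∀ j → j < N → ¬ p ∣ c * suc j
  p∤c·j j j<N p∣cj with euclidsLemma c (suc j) pp p∣cj
  ... | inj₁ p∣c = p∤c p∣c
  ... | inj₂ p∣j = 0<a<p⇒∤ z<s (s<s j<N) p∣j

  g-permutes : Π< N g ≡ F
  g-permutes = begin
    Π< N g                               ≡⟨ *-identityˡ (Π< N g) ⟨
    1 * Π< N g                           ≡⟨ cong (λ x → nonzero (x % p) * Π< N g) (*-zeroʳ c) ⟨
    Π< p (λ j → nonzero ((c * j) % p))   ≡⟨ sum-unit-invariant *-1-commutativeMonoid p c _ (proj₂ c⁻¹) nonzero ⟨
    Π< p nonzero                         ≡⟨ *-identityˡ F ⟩
    F                                    ∎
    where open ≡-Reasoning

  cᴺF≡F : (c ^ N * F) % p ≡ F % p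
  cᴺF≡F = begin
    (c ^ N * F) % p             ≡⟨ cong (_% p) (Π<-scale N c suc) ⟨
    Π< N (λ j → c * suc j) % p  ≡⟨ Π<-cong-% N g (λ j → c * suc j) g≡c·j ⟨
    Π< N g % p                  ≡⟨ cong (_% p) g-permutes ⟩
    F % p                       ∎
    where
    open ≡-Reasoning
    g≡c·j : ∀ j → j < N → g j % p ≡ (c * suc j) % p
    g≡c·j j j<N = trans (cong (_% p) (nonzero-% (c * suc j) (p∤c·j j j<N))) (m%n%n≡m%n (c * suc j) p)

  p∣F·[cᴺ∸1] : p ∣ F * (c ^ N ∸ 1)
  p∣F·[cᴺ∸1] = subst (p ∣_) (*-comm (c ^ N ∸ 1) F) (fixed⇒∣ cᴺ≥1 cᴺF≡F)

δ : ℕ → ℕ → ℕ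
δ zero    zero    = 1
δ zero    (suc _) = 0
δ (suc _) zero    = 0
δ (suc x) (suc y) = δ x y

δ-refl : ∀ x → δ x x ≡ 1
δ-refl zero    = refl
δ-refl (suc x) = δ-refl x

δ-≡ : ∀ {x y} → x ≡ y → δ x y ≡ 1
δ-≡ {x} refl = δ-refl x

δ-≢ : ∀ {x y} → x ≢ y → δ x y ≡ 0
δ-≢ {zero}  {zero}  x≢y = contradiction refl x≢y
δ-≢ {zero}  {suc _} _   = refl
δ-≢ {suc _} {zero}  _   = refl
δ-≢ {suc x} {suc y} x≢y = δ-≢ (λ x≡y → x≢y (cong suc x≡y))

Σ<-zero : ∀ N → Σ< N (λ _ → 0) ≡ 0
Σ<-zero N = trans (Σ<-const N 0) (*-zeroʳ N)

Σ<-δ : ∀ N z h → z < N → Σ< N (λ y → δ z y * h y) ≡ h z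
Σ<-δ (suc N) zero    h _         = trans (cong (h 0 + 0 +_) (Σ<-zero N)) (trans (+-identityʳ _) (+-identityʳ _))
Σ<-δ (suc N) (suc z) h (s<s z<N) = Σ<-δ N z (λ y → h (suc y)) z<N

Σ<-δ≤1 : ∀ N z → Σ< N (λ x → δ x z) ≤ 1
Σ<-δ≤1 zero    z       = z≤n
Σ<-δ≤1 (suc N) zero    = ≤-reflexive (cong suc (Σ<-zero N))
Σ<-δ≤1 (suc N) (suc z) = Σ<-δ≤1 N z

∣<2*⇒ : ∀ {p s} → p ∣ s → s < 2 * p → s ≡ 0 ⊎ s ≡ p
∣<2*⇒ (divides zero          refl) _ = inj₁ refl
∣<2*⇒ (divides (suc zero)    refl) _ = inj₂ (+-identityʳ _)
∣<2*⇒ {p} (divides (suc (suc k)) refl) s<2p =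
  contradiction s<2p (≤⇒≯ (+-monoʳ-≤ p (≤-trans (≤-reflexive (+-identityʳ p)) (m≤m+n p (k * p)))))

module _ {p : ℕ} .{{_ : NonZero p}} (pp : Prime p) where

  -- Write x = x₀ + t. Since x² − x₀² = t (x₀ + x), the prime p divides t or
  -- x₀ + x, and both are small enough to pin down.
  square-roots-shift : ∀ x₀ t → x₀ + t < p → p ∣ t * (x₀ + (x₀ + t)) → t ≡ 0 ⊎ x₀ + (x₀ + t) ≡ p
  square-roots-shift x₀ t x<p p∣t·s with euclidsLemma t (x₀ + (x₀ + t)) pp p∣t·s
  ... | inj₁ p∣t = inj₁ (∣∧<⇒≡0 p∣t (≤-<-trans (m≤n+m t x₀) x<p))
  ... | inj₂ p∣s with ∣<2*⇒ p∣s s<2p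
    where
    s<2p : x₀ + (x₀ + t) < 2 * p
    s<2p = subst (x₀ + (x₀ + t) <_) (cong (p +_) (sym (+-identityʳ p)))
                 (+-mono-<-≤ (≤-<-trans (m≤m+n x₀ t) x<p) (<⇒≤ x<p))
  ...   | inj₁ s≡0 = inj₁ (m+n≡0⇒n≡0 x₀ (m+n≡0⇒n≡0 x₀ s≡0))
  ...   | inj₂ s≡p = inj₂ s≡p

  square-roots-≤ : ∀ x₀ x → x₀ ≤ x → x < p → (x * x) % p ≡ (x₀ * x₀) % p → x ≡ x₀ ⊎ x₀ + x ≡ p
  square-roots-≤ x₀ x x₀≤x x<p x²≡x₀² with square-roots-shift x₀ t (subst (_< p) x≡x₀+t x<p) p∣t·s
    where
    t = x ∸ x₀
    x≡x₀+t : x ≡ x₀ + t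
    x≡x₀+t = sym (m+[n∸m]≡n x₀≤x)
    expand : ∀ a t → (a + t) * (a + t) ≡ a * a + t * (a + (a + t))
    expand = solve 2 (λ a t → (a :+ t) :* (a :+ t) := a :* a :+ t :* (a :+ (a :+ t))) refl
    p∣t·s : p ∣ t * (x₀ + (x₀ + t))
    p∣t·s = subst (p ∣_) (begin
      x * x ∸ x₀ * x₀                    ≡⟨ cong (λ y → y * y ∸ x₀ * x₀) x≡x₀+t ⟩
      (x₀ + t) * (x₀ + t) ∸ x₀ * x₀      ≡⟨ cong (_∸ x₀ * x₀) (expand x₀ t) ⟩
      x₀ * x₀ + t * (x₀ + (x₀ + t)) ∸ x₀ * x₀ ≡⟨ m+n∸m≡n (x₀ * x₀) _ ⟩
      t * (x₀ + (x₀ + t))                ∎) (%≡⇒∣∸ (*-mono-≤ x₀≤x x₀≤x) x²≡x₀²)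
      where open ≡-Reasoning
  ... | inj₁ t≡0   = inj₁ (trans (sym (m+[n∸m]≡n x₀≤x)) (trans (cong (x₀ +_) t≡0) (+-identityʳ x₀)))
  ... | inj₂ s≡p   = inj₂ (trans (cong (x₀ +_) (sym (m+[n∸m]≡n x₀≤x))) s≡p)

  square-roots : ∀ x₀ x → x₀ < p → x < p → (x * x) % p ≡ (x₀ * x₀) % p → x ≡ x₀ ⊎ x₀ + x ≡ p
  square-roots x₀ x x₀<p x<p x²≡x₀² with ≤-total x₀ x
  ... | inj₁ x₀≤x = square-roots-≤ x₀ x x₀≤x x<p x²≡x₀²
  ... | inj₂ x≤x₀ with square-roots-≤ x x₀ x≤x₀ x₀<p (sym x²≡x₀²)
  ...   | inj₁ x₀≡x   = inj₁ (sym x₀≡x)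
  ...   | inj₂ x+x₀≡p = inj₂ (trans (+-comm x₀ x) x+x₀≡p)

  #square-roots≤2 : ∀ y → Σ< p (λ x → δ ((x * x) % p) y) ≤ 2
  #square-roots≤2 y with any? (λ (i : Fin p) → (toℕ i * toℕ i) % p ≟ y)
  ... | no no-root = ≤-trans (Σ<-mono p not-root) (≤-trans (≤-reflexive (Σ<-zero p)) z≤n)
    where
    not-root : ∀ x → x < p → δ ((x * x) % p) y ≤ 0
    not-root x x<p = ≤-reflexive (δ-≢ λ x²≡y →
      no-root (fromℕ< x<p , subst (λ z → (z * z) % p ≡ y) (sym (toℕ-fromℕ< x<p)) x²≡y))
  ... | yes (i , x₀²≡y) = begin
    Σ< p (λ x → δ ((x * x) % p) y)
      ≤⟨ Σ<-mono p one-of-two ⟩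
    Σ< p (λ x → δ x x₀ + δ x (p ∸ x₀))
      ≡⟨ Σ.∑-distrib-+ {p} (λ i → δ (toℕ i) x₀) (λ i → δ (toℕ i) (p ∸ x₀)) ⟩
    Σ< p (λ x → δ x x₀) + Σ< p (λ x → δ x (p ∸ x₀))
      ≤⟨ +-mono-≤ (Σ<-δ≤1 p x₀) (Σ<-δ≤1 p (p ∸ x₀)) ⟩
    2 ∎
    where
    open ≤-Reasoning
    x₀ = toℕ i
    one-of-two : ∀ x → x < p → δ ((x * x) % p) y ≤ δ x x₀ + δ x (p ∸ x₀)
    one-of-two x x<p with (x * x) % p ≟ y
    ... | no x²≢y = ≤-trans (≤-reflexive (δ-≢ x²≢y)) z≤n
    ... | yes x²≡y with square-roots x₀ x (toℕ<n i) x<p (trans x²≡y (sym x₀²≡y))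
    ...   | inj₁ x≡x₀   = ≤-trans (≤-reflexive (trans (δ-≡ x²≡y) (sym (δ-≡ x≡x₀)))) (m≤m+n _ _)
    ...   | inj₂ x₀+x≡p = ≤-trans (≤-reflexive (trans (δ-≡ x²≡y) (sym (δ-≡ x≡p∸x₀)))) (m≤n+m _ _)
      where
      x≡p∸x₀ : x ≡ p ∸ x₀
      x≡p∸x₀ = trans (sym (m+n∸m≡n x₀ x)) (cong (_∸ x₀) x₀+x≡p)

  Σ<-squares : ∀ h → Σ< p (λ x → h ((x * x) % p)) ≤ 2 * Σ< p h
  Σ<-squares h = begin
    Σ< p (λ x → h (sq x))
      ≡⟨ Σ.sum-cong-≗ {p} (λ i → sym (Σ<-δ p (sq (toℕ i)) h (m%n<n _ p))) ⟩
    Σ< p (λ x → Σ< p (λ y → δ (sq x) y * h y))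
      ≡⟨ Σ.∑-comm {p} {p} (λ i j → δ (sq (toℕ i)) (toℕ j) * h (toℕ j)) ⟩
    Σ< p (λ y → Σ< p (λ x → δ (sq x) y * h y))
      ≡⟨ Σ.sum-cong-≗ {p} (λ j → sym (Σ.*-distribʳ-sum {p} (h (toℕ j)) (λ i → δ (sq (toℕ i)) (toℕ j)))) ⟩
    Σ< p (λ y → Σ< p (λ x → δ (sq x) y) * h y)
      ≤⟨ Σ<-mono p (λ y _ → *-monoˡ-≤ (h y) (#square-roots≤2 y)) ⟩
    Σ< p (λ y → 2 * h y)
      ≡⟨ Σ.*-distribˡ-sum {p} 2 (λ j → h (toℕ j)) ⟨
    2 * Σ< p h ∎
    where
    open ≤-Reasoning
    sq : ℕ → ℕ
    sq x = (x * x) % p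

  R : ℕ → ℕ
  R s = Σ< p (λ x → δ ((x ^ (2 ^ s)) % p) 1)

  -- Squaring maps the solutions for 2 ^ (s + 1) onto those for 2 ^ s, so there
  -- are at most 2 ^ s of them.
  R≤2^ : ∀ s → R s ≤ 2 ^ s
  R≤2^ zero = ≤-trans (Σ<-mono p (λ x x<p → ≤-reflexive (cong (λ z → δ z 1) (x¹%p≡x x<p)))) (Σ<-δ≤1 p 1)
    where
    x¹%p≡x : ∀ {x} → x < p → (x ^ 1) % p ≡ x
    x¹%p≡x {x} x<p = trans (cong (_% p) (*-identityʳ x)) (m<n⇒m%n≡m x<p)
  R≤2^ (suc s) = begin
    R (suc s)                                           ≡⟨ Σ.sum-cong-≗ {p} (λ i → cong (λ z → δ z 1) (squares (toℕ i))) ⟨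
    Σ< p (λ x → δ ((((x * x) % p) ^ (2 ^ s)) % p) 1)    ≤⟨ Σ<-squares (λ y → δ ((y ^ (2 ^ s)) % p) 1) ⟩
    2 * R s                                             ≤⟨ *-monoʳ-≤ 2 (R≤2^ s) ⟩
    2 ^ suc s                                           ∎
    where
    open ≤-Reasoning
    squares : ∀ x → (((x * x) % p) ^ (2 ^ s)) % p ≡ (x ^ (2 ^ suc s)) % p
    squares x = begin-equality
      (((x * x) % p) ^ (2 ^ s)) % p ≡⟨ %-cong-^ (2 ^ s) (m%n%n≡m%n (x * x) p) ⟩
      ((x * x) ^ (2 ^ s)) % p       ≡⟨ cong (λ z → ((x * z) ^ (2 ^ s)) % p) (*-identityʳ x) ⟨
      ((x ^ 2) ^ (2 ^ s)) % p       ≡⟨ cong (_% p) (^-*-assoc x 2 (2 ^ s)) ⟩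
      (x ^ (2 ^ suc s)) % p         ∎

∣2^⇒2^ : ∀ J {d} → d ∣ 2 ^ J → ∃ λ s → d ≡ 2 ^ s
∣2^⇒2^ zero    d∣1 = 0 , ∣1⇒≡1 d∣1
∣2^⇒2^ (suc J) {d} d∣2^J+1 with 2 ∣? d
... | yes (divides d′ refl) with ∣2^⇒2^ J {d′} (*-cancelˡ-∣ 2 (subst (_∣ 2 * 2 ^ J) (*-comm d′ 2) d∣2^J+1))
...   | s , refl = suc s , *-comm (2 ^ s) 2
∣2^⇒2^ (suc J) {d} d∣2^J+1 | no 2∤d =
  ∣2^⇒2^ J (coprime-divisor (Coprime.sym (prime∤⇒coprime prime[2] 2∤d)) d∣2^J+1)

bezout-^-one : ∀ {q} .{{_ : NonZero q}} x {d a b} → Bézout.Identity d a b →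
               (x ^ a) % q ≡ 1 % q → (x ^ b) % q ≡ 1 % q → (x ^ d) % q ≡ 1 % q
bezout-^-one {q} x (Bézout.+- u v d+vb≡ua) xᵃ≡1 xᵇ≡1 = combine u v d+vb≡ua xᵃ≡1 xᵇ≡1
  where
  multiple : ∀ a k → (x ^ a) % q ≡ 1 % q → (x ^ (k * a)) % q ≡ 1 % q
  multiple a k xᵃ≡1 = trans (cong (_% q) (trans (cong (x ^_) (*-comm k a)) (sym (^-*-assoc x a k)))) (^-one k xᵃ≡1)
  combine : ∀ {d a b} u v → d + v * b ≡ u * a → (x ^ a) % q ≡ 1 % q → (x ^ b) % q ≡ 1 % q → (x ^ d) % q ≡ 1 % q
  combine {d} {a} {b} u v d+vb≡ua xᵃ≡1 xᵇ≡1 = begin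
    (x ^ d) % q                  ≡⟨ cong (_% q) (*-identityʳ (x ^ d)) ⟨
    (x ^ d * 1) % q              ≡⟨ %-cong-* {a = x ^ d} refl (multiple b v xᵇ≡1) ⟨
    (x ^ d * x ^ (v * b)) % q    ≡⟨ cong (_% q) (^-distribˡ-+-* x d (v * b)) ⟨
    (x ^ (d + v * b)) % q        ≡⟨ cong (λ e → (x ^ e) % q) d+vb≡ua ⟩
    (x ^ (u * a)) % q            ≡⟨ multiple a u xᵃ≡1 ⟩
    1 % q                        ∎
    where open ≡-Reasoning
bezout-^-one x (Bézout.-+ u v d+ua≡vb) xᵃ≡1 xᵇ≡1 = bezout-^-one x (Bézout.+- v u d+ua≡vb) xᵇ≡1 xᵃ≡1

-- If p ∸ 1 does not divide 2 ^ J, not every unit x mod p satisfies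
-- x ^ (2 ^ J) ≡ 1: with Fermat and Bézout all p ∸ 1 units would satisfy
-- x ^ d ≡ 1 for d = gcd (2 ^ J) (p ∸ 1) = 2 ^ s < p ∸ 1, while R≤2^ allows at
-- most 2 ^ s such x.
¬all-units-roots : ∀ {p} .{{_ : NonZero p}} → Prime p → ∀ J → ¬ (p ∸ 1) ∣ 2 ^ J →
                   ¬ (∀ x → 0 < x → x < p → (x ^ (2 ^ J)) % p ≡ 1 % p)
¬all-units-roots {p@(suc (suc N′))} pp J p-1∤2ᴶ all-roots with Bézout.lemma (2 ^ J) (suc N′)
... | Bézout.result d gcd bezout with ∣2^⇒2^ J (GCD.gcd∣m gcd)
...   | s , refl = <⇒≱ 2ˢ<p-1 p-1≤2ˢ
  where
  N = suc N′
  roots-2ˢ : ∀ x → 0 < x → x < p → (x ^ (2 ^ s)) % p ≡ 1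
  roots-2ˢ x x>0 x<p = bezout-^-one x bezout (all-roots x x>0 x<p) (fermat pp x (0<a<p⇒∤ x>0 x<p))
  units-are-roots : ∀ j → j < N → (suc j ^ (2 ^ s)) % p ≡ 1
  units-are-roots j j<N = roots-2ˢ (suc j) z<s (s<s j<N)
  p-1≤2ˢ : N ≤ 2 ^ s
  p-1≤2ˢ = begin
    N                                          ≡⟨ *-identityʳ N ⟨
    N * 1                                      ≡⟨ Σ<-const N 1 ⟨
    Σ< N (λ _ → 1)                             ≤⟨ Σ<-mono N (λ j j<N → ≤-reflexive (sym (δ-≡ (units-are-roots j j<N)))) ⟩
    Σ< N (λ j → δ ((suc j ^ (2 ^ s)) % p) 1)   ≤⟨ m≤n+m _ (δ ((0 ^ (2 ^ s)) % p) 1) ⟩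
    R pp s                                     ≤⟨ R≤2^ pp s ⟩
    2 ^ s                                      ∎
    where open ≤-Reasoning
  2ˢ<p-1 : 2 ^ s < N
  2ˢ<p-1 with m≤n⇒m<n∨m≡n (∣⇒≤ (GCD.gcd∣n gcd))
  ... | inj₁ 2ˢ<N = 2ˢ<N
  ... | inj₂ 2ˢ≡N = contradiction (subst (_∣ 2 ^ J) 2ˢ≡N (GCD.gcd∣m gcd)) p-1∤2ᴶ

non-root : ∀ {p} .{{_ : NonZero p}} → Prime p → ∀ J → ¬ (p ∸ 1) ∣ 2 ^ J →
           ∃ λ c → ¬ p ∣ c × ¬ p ∣ c ^ (2 ^ J) ∸ 1
non-root {p} pp J p-1∤2ᴶ
  with ¬∀⟶∃¬ p (λ i → Trivial (toℕ i)) (λ i → (toℕ i ≟ 0) ⊎-dec ((toℕ i ^ (2 ^ J)) % p ≟ 1 % p))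
             (¬all-units-roots pp J p-1∤2ᴶ ∘′ all-roots)
  where
  Trivial : ℕ → Set
  Trivial x = x ≡ 0 ⊎ (x ^ (2 ^ J)) % p ≡ 1 % p
  all-roots : (∀ (i : Fin p) → Trivial (toℕ i)) → ∀ x → 0 < x → x < p → (x ^ (2 ^ J)) % p ≡ 1 % p
  all-roots all-trivial x x>0 x<p with subst Trivial (toℕ-fromℕ< x<p) (all-trivial (fromℕ< x<p))
  ... | inj₁ x≡0  = contradiction x≡0 (n>0⇒n≢0 x>0)
  ... | inj₂ xᴷ≡1 = xᴷ≡1
... | i , nontrivial = toℕ i , p∤c , p∤cᴷ∸1
  where
  c>0 : 0 < toℕ i
  c>0 = n≢0⇒n>0 (nontrivial ∘′ inj₁)
  p∤c : ¬ p ∣ toℕ i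
  p∤c = 0<a<p⇒∤ c>0 (toℕ<n i)
  p∤cᴷ∸1 : ¬ p ∣ toℕ i ^ (2 ^ J) ∸ 1
  p∤cᴷ∸1 = nontrivial ∘′ inj₂ ∘′ ∣∸⇒%≡ (^-positive (2 ^ J) c>0)

-- If c is invertible modulo q and c ^ k ∸ 1 is coprime to q,
-- then q divides the power sum Σ_{j<N} j ^ k: multiplying the residues by c
-- permutes them, so c ^ k fixes X = Σ_{j<q} j ^ k modulo q, forcing q ∣ X;
-- and the sum over j < N is N / q copies of X modulo q.
power-sum-vanishes : ∀ q .{{_ : NonZero q}} N k {c u} → q ∣ N → (c * u) % q ≡ 1 % q →
                     1 ≤ c ^ k → Coprime q (c ^ k ∸ 1) → q ∣ Σ< N (λ j → j ^ k)
power-sum-vanishes q N k {c} {u} (divides b refl) cu≡1 cᵏ≥1 q⊥cᵏ-1 = m%n≡0⇒n∣m _ q (begin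
  Σ< (b * q) f % q ≡⟨ Σ<-periodic b f periodic ⟩
  (b * X) % q      ≡⟨ %-cong-* {a = b} refl (trans (n∣m⇒m%n≡0 X q q∣X) (sym (n∣m⇒m%n≡0 0 q (q ∣0)))) ⟩
  (b * 0) % q      ≡⟨ cong (_% q) (*-zeroʳ b) ⟩
  0 % q            ≡⟨ n∣m⇒m%n≡0 0 q (q ∣0) ⟩
  0                ∎)
  where
  open ≡-Reasoning
  f : ℕ → ℕ
  f j = j ^ k
  X = Σ< q f
  periodic : ∀ j → f (q + j) % q ≡ f j % q
  periodic j = %-cong-^ k (trans (cong (_% q) (+-comm q j)) ([m+n]%n≡m%n j q))
  c·j-residue : ∀ j → (((c * j) % q) ^ k) % q ≡ (c ^ k * j ^ k) % q
  c·j-residue j = trans (%-cong-^ k (m%n%n≡m%n (c * j) q)) (cong (_% q) (^-distribʳ-* c j k))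
  cᵏX≡X : (c ^ k * X) % q ≡ X % q
  cᵏX≡X = begin
    (c ^ k * X) % q                       ≡⟨ cong (_% q) (Σ.*-distribˡ-sum {q} (c ^ k) (λ i → f (toℕ i))) ⟩
    Σ< q (λ j → c ^ k * j ^ k) % q        ≡⟨ Σ<-cong-% q _ _ (λ j _ → sym (c·j-residue j)) ⟩
    Σ< q (λ j → ((c * j) % q) ^ k) % q    ≡⟨ cong (_% q) (sum-unit-invariant +-0-commutativeMonoid q c u cu≡1 f) ⟨
    X % q                                 ∎
  q∣X : q ∣ X
  q∣X = coprime-divisor q⊥cᵏ-1 (fixed⇒∣ cᵏ≥1 cᵏX≡X)

prime-factor : ∀ d → 1 < d → ∃ λ p → Prime p × p ∣ d
prime-factor (suc zero) (s≤s ())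
prime-factor d@(suc (suc _)) _ with factorise d
... | record { factors = [] ; isFactorisation = () }
... | record { factors = p ∷ ps ; isFactorisation = d≡p*Πps ; factorsPrime = pp ∷ _ } =
  p , pp , subst (p ∣_) (sym d≡p*Πps) (m∣m*n _)

p-part : ∀ {p} → Prime p → ∀ d → 0 < d → ∃₂ λ a e → d ≡ p ^ a * e × ¬ p ∣ e
p-part {p} pp = <-rec _ split
  where
  instance _ = prime⇒nonTrivial pp
  split : ∀ d → (∀ {d′} → d′ < d → 0 < d′ → ∃₂ λ a e → d′ ≡ p ^ a * e × ¬ p ∣ e) →
          0 < d → ∃₂ λ a e → d ≡ p ^ a * e × ¬ p ∣ e
  split d rec d>0 with p ∣? d
  ... | no p∤d = 0 , d , sym (+-identityʳ d) , p∤d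
  ... | yes (divides d′ refl) with rec (m<m*n d′ p (nonTrivial⇒n>1 p)) (>-nonZero⁻¹ d′)
    where instance _ = m*n≢0⇒m≢0 d′ {{>-nonZero d>0}}
  ...   | a , e , d′≡pᵃe , p∤e =
    suc a , e , trans (trans (cong (_* p) d′≡pᵃe) (*-comm _ p)) (sym (*-assoc p (p ^ a) e)) , p∤e

coprime⇒*∣ : ∀ {m n s} → Coprime m n → m ∣ s → n ∣ s → m * n ∣ s
coprime⇒*∣ {m} {n} m⊥n (divides t refl) n∣tm = subst (m * n ∣_) (*-comm m t)
  (*-monoʳ-∣ m (coprime-divisor (Coprime.sym m⊥n) (subst (n ∣_) (*-comm t m) n∣tm)))

-- n divides S as soon as every prime power dividing n divides S: by strong
-- induction, every divisor d = p ^ a * e of n (p ∣ d, p ∤ e) divides S.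
prime-powers⇒∣ : ∀ {n S} → 0 < n → (∀ p a → Prime p → p ^ a ∣ n → p ^ a ∣ S) → n ∣ S
prime-powers⇒∣ {n} {S} n>0 prime-power∣S = <-rec (λ d → d ∣ n → d ∣ S) divisor∣S n ∣-refl
  where
  divisor∣S : ∀ d → (∀ {e} → e < d → e ∣ n → e ∣ S) → d ∣ n → d ∣ S
  divisor∣S zero          _   0∣n = contradiction (0∣⇒≡0 0∣n) (n>0⇒n≢0 n>0)
  divisor∣S (suc zero)    _   _   = 1∣ S
  divisor∣S d@(suc (suc _)) rec d∣n with prime-factor d (s≤s (s≤s z≤n))
  ... | p , pp , p∣d with p-part pp d z<s
  ...   | a , e , d≡pᵃe , p∤e = subst (_∣ S) (sym d≡pᵃe) (coprime⇒*∣ pᵃ⊥e pᵃ∣S e∣S)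
    where
    e∣d : e ∣ d
    e∣d = subst (e ∣_) (sym d≡pᵃe) (n∣m*n (p ^ a))
    e<d : e < d
    e<d = ≤∧≢⇒< (∣⇒≤ e∣d) (λ e≡d → p∤e (subst (p ∣_) (sym e≡d) p∣d))
    pᵃ⊥e : Coprime (p ^ a) e
    pᵃ⊥e = Coprime.sym (coprime-^ a (Coprime.sym (prime∤⇒coprime pp p∤e)))
    pᵃ∣S : p ^ a ∣ S
    pᵃ∣S = prime-power∣S p a pp (∣-trans (subst (p ^ a ∣_) (sym d≡pᵃe) (m∣m*n e)) d∣n)
    e∣S : e ∣ S
    e∣S = rec e<d (∣-trans e∣d d∣n)

2∤odd : ∀ k → ¬ 2 ∣ suc (2 * k)
2∤odd k 2∣odd = contradiction (∣1⇒≡1 (∣m+n∣m⇒∣n (subst (2 ∣_) (+-comm 1 (2 * k)) 2∣odd) (m∣m*n k))) λ ()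

¬2∣⇒odd : ∀ a → ¬ 2 ∣ a → ∃ λ v → a ≡ suc (2 * v)
¬2∣⇒odd a 2∤a with a % 2 in a%2≡r | m%n<n a 2
... | zero  | _ = contradiction (m%n≡0⇒n∣m a 2 a%2≡r) 2∤a
... | suc zero | _ = a / 2 , trans (m≡m%n+[m/n]*n a 2) (trans (cong (_+ a / 2 * 2) a%2≡r) (cong suc (*-comm (a / 2) 2)))
... | suc (suc _) | s≤s (s≤s ())

-- Modulo a + 1 we have a ≡ −1, so a² ≡ 1 …
a²≡1 : ∀ a → (a * a) % suc a ≡ 1 % suc a
a²≡1 zero    = refl
a²≡1 (suc b) = trans (cong (_% suc (suc b)) (expand b)) ([m+kn]%n≡m%n 1 b (suc (suc b)))
  where
  expand : ∀ b → suc b * suc b ≡ 1 + b * suc (suc b)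
  expand = solve 1 (λ b → (con 1 :+ b) :* (con 1 :+ b) := con 1 :+ b :* (con 2 :+ b)) refl

a+1∣a^odd+1 : ∀ a k → suc a ∣ a ^ suc (2 * k) + 1
a+1∣a^odd+1 a k = m%n≡0⇒n∣m _ (suc a) (begin
  (a * a ^ (2 * k) + 1) % suc a
    ≡⟨ %-cong-+ {suc a} {a * a ^ (2 * k)} {a * 1} {1} {1} (%-cong-* {suc a} {a} {a} {a ^ (2 * k)} {1} refl a²ᵏ≡1) refl ⟩
  (a * 1 + 1) % suc a           ≡⟨ cong (λ x → (x + 1) % suc a) (*-identityʳ a) ⟩
  (a + 1) % suc a               ≡⟨ cong (_% suc a) (+-comm a 1) ⟩
  suc a % suc a                 ≡⟨ n%n≡0 (suc a) ⟩
  0                             ∎)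
  where
  open ≡-Reasoning
  a²ᵏ≡1 : (a ^ (2 * k)) % suc a ≡ 1 % suc a
  a²ᵏ≡1 = trans (cong (_% suc a) (sym (^-*-assoc a 2 k)))
                (^-one k (trans (cong (λ x → (a * x) % suc a) (*-identityʳ a)) (a²≡1 a)))

-- Let P = 2 ^ s + 1 with s > 0. Then 2 ^ s ≡ −1 modulo P, so 2 has order 2s.
module _ (s : ℕ) .{{_ : NonZero s}} where

  private
    P = suc (2 ^ s)
    instance _ = m*n≢0 s 2

  P∣2^[m%2s]+1 : ∀ m → P ∣ 2 ^ m + 1 → P ∣ 2 ^ (m % (s * 2)) + 1
  P∣2^[m%2s]+1 m P∣2ᵐ+1 = m%n≡0⇒n∣m _ P (begin
    (2 ^ r + 1) % P                   ≡⟨ %-cong-+ {P} {2 ^ r} {2 ^ r * (2 ^ (s * 2)) ^ w} {1} {1} 2ʳ≡2ᵐ refl ⟩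
    (2 ^ r * (2 ^ (s * 2)) ^ w + 1) % P ≡⟨ cong (λ x → (x + 1) % P) 2ᵐ≡ ⟨
    (2 ^ m + 1) % P                   ≡⟨ n∣m⇒m%n≡0 _ P P∣2ᵐ+1 ⟩
    0                                 ∎)
    where
    open ≡-Reasoning
    r = m % (s * 2)
    w = m / (s * 2)
    2²ˢ≡1 : (2 ^ (s * 2)) % P ≡ 1 % P
    2²ˢ≡1 = trans (cong (_% P) (trans (sym (^-*-assoc 2 s 2)) (cong (2 ^ s *_) (*-identityʳ (2 ^ s))))) (a²≡1 (2 ^ s))
    2ʳ≡2ᵐ : (2 ^ r) % P ≡ (2 ^ r * (2 ^ (s * 2)) ^ w) % P
    2ʳ≡2ᵐ = trans (cong (_% P) (sym (*-identityʳ (2 ^ r)))) (%-cong-* {P} {2 ^ r} {2 ^ r} {1} refl (sym (^-one w 2²ˢ≡1)))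
    2ᵐ≡ : 2 ^ m ≡ 2 ^ r * (2 ^ (s * 2)) ^ w
    2ᵐ≡ = begin
      2 ^ m                          ≡⟨ cong (2 ^_) (trans (m≡m%n+[m/n]*n m (s * 2)) (cong (r +_) (*-comm w (s * 2)))) ⟩
      2 ^ (r + s * 2 * w)            ≡⟨ ^-distribˡ-+-* 2 r (s * 2 * w) ⟩
      2 ^ r * 2 ^ (s * 2 * w)        ≡⟨ cong (2 ^ r *_) (^-*-assoc 2 (s * 2) w) ⟨
      2 ^ r * (2 ^ (s * 2)) ^ w      ∎

  -- If 2 ^ (s + t) + 1 ≡ 0 with t < s, then P ∣ 2 ^ t ∸ 1 because
  -- 2 ^ (s + t) ≡ −2 ^ t; as 2 ^ t ∸ 1 < P this forces t = 0.
  P∣2^[s+t]+1⇒t≡0 : ∀ t → t < s → P ∣ 2 ^ (s + t) + 1 → t ≡ 0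
  P∣2^[s+t]+1⇒t≡0 t t<s P∣2ˢ⁺ᵗ+1 with m^n≡1⇒n≡0∨m≡1 2 t (trans 2ᵗ≡1+u (cong suc u≡0))
    where
    u = 2 ^ t ∸ 1
    2ᵗ≡1+u : 2 ^ t ≡ suc u
    2ᵗ≡1+u = sym (m+[n∸m]≡n (m^n>0 2 t))
    rearrange : ∀ a u → (a * suc u + 1) + u ≡ suc a * suc u
    rearrange = solve 2 (λ a u → (a :* (con 1 :+ u) :+ con 1) :+ u := (con 1 :+ a) :* (con 1 :+ u)) refl
    P∣[2ˢ⁺ᵗ+1]+u : P ∣ (2 ^ s * suc u + 1) + u
    P∣[2ˢ⁺ᵗ+1]+u = subst (P ∣_) (sym (rearrange (2 ^ s) u)) (m∣m*n (suc u))
    2ˢ⁺ᵗ≡ : 2 ^ (s + t) ≡ 2 ^ s * suc u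
    2ˢ⁺ᵗ≡ = trans (^-distribˡ-+-* 2 s t) (cong (2 ^ s *_) 2ᵗ≡1+u)
    u<P : u < P
    u<P = ≤-trans (≤-reflexive (sym 2ᵗ≡1+u)) (≤-trans (<⇒≤ (^-monoʳ-< 2 (s≤s (s≤s z≤n)) t<s)) (n≤1+n (2 ^ s)))
    u≡0 : u ≡ 0
    u≡0 = ∣∧<⇒≡0 (∣m+n∣m⇒∣n P∣[2ˢ⁺ᵗ+1]+u (subst (λ x → P ∣ x + 1) 2ˢ⁺ᵗ≡ P∣2ˢ⁺ᵗ+1)) u<P
  ... | inj₁ t≡0 = t≡0
  ... | inj₂ ()

  P∣2^r+1⇒r≡s : ∀ r → r < s * 2 → P ∣ 2 ^ r + 1 → r ≡ s
  P∣2^r+1⇒r≡s r r<2s P∣2ʳ+1 with ≤-total s r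
  ... | inj₂ r≤s with m≤n⇒m<n∨m≡n r≤s
  ...   | inj₂ r≡s = r≡s
  ...   | inj₁ r<s = contradiction (trans (+-comm 1 (2 ^ r)) (∣∧<⇒≡0 P∣2ʳ+1 (s≤s 2ʳ+1≤2ˢ))) 1+n≢0
    where
    2ʳ+1≤2ˢ : 2 ^ r + 1 ≤ 2 ^ s
    2ʳ+1≤2ˢ = subst (_≤ 2 ^ s) (+-comm 1 (2 ^ r)) (^-monoʳ-< 2 (s≤s (s≤s z≤n)) r<s)
  P∣2^r+1⇒r≡s r r<2s P∣2ʳ+1 | inj₁ s≤r = begin
    r            ≡⟨ s+t≡r ⟨
    s + t        ≡⟨ cong (s +_) (P∣2^[s+t]+1⇒t≡0 t t<s (subst (λ x → P ∣ 2 ^ x + 1) (sym s+t≡r) P∣2ʳ+1)) ⟩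
    s + 0        ≡⟨ +-identityʳ s ⟩
    s            ∎
    where
    open ≡-Reasoning
    t = r ∸ s
    s+t≡r : s + t ≡ r
    s+t≡r = m+[n∸m]≡n s≤r
    t<s : t < s
    t<s = +-cancelˡ-< s t s (subst₂ _<_ (sym s+t≡r) (trans (*-comm s 2) (cong (s +_) (+-identityʳ s))) r<2s)

  P∣2^m+1⇒odd-multiple : ∀ m → P ∣ 2 ^ m + 1 → ∃ λ w → m ≡ s * suc (2 * w)
  P∣2^m+1⇒odd-multiple m P∣2ᵐ+1 = w , (begin
    m                         ≡⟨ m≡m%n+[m/n]*n m (s * 2) ⟩
    m % (s * 2) + w * (s * 2) ≡⟨ cong (_+ w * (s * 2)) r≡s ⟩
    s + w * (s * 2)           ≡⟨ collect s w ⟩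
    s * suc (2 * w)           ∎)
    where
    open ≡-Reasoning
    w = m / (s * 2)
    r≡s : m % (s * 2) ≡ s
    r≡s = P∣2^r+1⇒r≡s (m % (s * 2)) (m%n<n m (s * 2)) (P∣2^[m%2s]+1 m P∣2ᵐ+1)
    collect : ∀ s w → s + w * (s * 2) ≡ s * suc (2 * w)
    collect = solve 2 (λ s w → s :+ w :* (s :* con 2) := s :* (con 1 :+ con 2 :* w)) refl

same-2-part : ∀ α s w k → s * suc (2 * w) ≡ 2 ^ α * suc (2 * k) → ∃ λ v → s ≡ 2 ^ α * suc (2 * v)
same-2-part α s w k s·odd≡2ᵅ·odd with 2ᵅ∣s
  where
  2ᵅ⊥odd : Coprime (2 ^ α) (suc (2 * w))
  2ᵅ⊥odd = Coprime.sym (coprime-^ α (Coprime.sym (prime∤⇒coprime prime[2] (2∤odd w))))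
  2ᵅ∣s : 2 ^ α ∣ s
  2ᵅ∣s = coprime-divisor 2ᵅ⊥odd
    (divides (suc (2 * k)) (trans (*-comm (suc (2 * w)) s) (trans s·odd≡2ᵅ·odd (*-comm (2 ^ α) _))))
... | divides v′ refl with ¬2∣⇒odd v′ 2∤v′
  where
  instance _ = m^n≢0 2 α
  v′·odd≡odd : v′ * suc (2 * w) ≡ suc (2 * k)
  v′·odd≡odd = *-cancelˡ-≡ _ _ (2 ^ α) (begin
    2 ^ α * (v′ * suc (2 * w)) ≡⟨ *-comm (2 ^ α) _ ⟩
    v′ * suc (2 * w) * 2 ^ α   ≡⟨ *-assoc v′ _ (2 ^ α) ⟩
    v′ * (suc (2 * w) * 2 ^ α) ≡⟨ cong (v′ *_) (*-comm (suc (2 * w)) (2 ^ α)) ⟩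
    v′ * (2 ^ α * suc (2 * w)) ≡⟨ *-assoc v′ (2 ^ α) _ ⟨
    v′ * 2 ^ α * suc (2 * w)   ≡⟨ s·odd≡2ᵅ·odd ⟩
    2 ^ α * suc (2 * k)        ∎)
    where open ≡-Reasoning
  2∤v′ : ¬ 2 ∣ v′
  2∤v′ 2∣v′ = 2∤odd k (subst (2 ∣_) v′·odd≡odd (∣-trans 2∣v′ (m∣m*n (suc (2 * w)))))
...   | v , refl = v , *-comm (suc (2 * v)) (2 ^ α)

2^α*odd>0 : ∀ α k → 0 < 2 ^ α * suc (2 * k)
2^α*odd>0 α k = <-≤-trans (m^n>0 2 α) (m≤m*n (2 ^ α) (suc (2 * k)))

2∤2^m+1 : ∀ m → 0 < m → ¬ 2 ∣ 2 ^ m + 1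
2∤2^m+1 (suc m) _ 2∣2ᵐ+1 = 2∤odd (2 ^ m) (subst (2 ∣_) (+-comm (2 ^ suc m) 1) 2∣2ᵐ+1)

-- Let m = 2 ^ α * (2k + 1). A prime divisor p of 2 ^ m + 1 for which p ∸ 1 is a
-- power of 2, say p = 2 ^ s + 1, must be the Fermat number 2 ^ (2 ^ α) + 1: s is
-- an odd multiple of 2 ^ α, so 2 ^ (2 ^ α) + 1 divides p.
fermat-divisor : ∀ α k J {p} → Prime p → p ∣ 2 ^ (2 ^ α * suc (2 * k)) + 1 → (p ∸ 1) ∣ 2 ^ J →
                 p ≡ 2 ^ (2 ^ α) + 1
fermat-divisor α k J {suc p-1} pp p∣2ᵐ+1 p-1∣2ᴶ with ∣2^⇒2^ J p-1∣2ᴶ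
... | zero    , refl = contradiction p∣2ᵐ+1 (2∤2^m+1 _ (2^α*odd>0 α k))
... | s@(suc _) , refl with P∣2^m+1⇒odd-multiple s (2 ^ α * suc (2 * k)) p∣2ᵐ+1
...   | w , m≡s·odd with same-2-part α s w k (sym m≡s·odd)
...     | v , s≡2ᵅ·odd with prime⇒irreducible pp F∣p
  where
  F = 2 ^ (2 ^ α)
  F∣p : suc F ∣ suc (2 ^ s)
  F∣p = subst (suc F ∣_) (trans (cong (_+ 1) (trans (^-*-assoc 2 (2 ^ α) _) (cong (2 ^_) (sym s≡2ᵅ·odd)))) (+-comm _ 1))
          (a+1∣a^odd+1 F v)
...       | inj₁ F+1≡1 = contradiction (suc-injective F+1≡1) (n>0⇒n≢0 (m^n>0 2 (2 ^ α)))
...       | inj₂ F+1≡p = trans (sym F+1≡p) (+-comm 1 _)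

sumFrom1≡Σ< : ∀ N f → f 0 ≡ 0 → sumFrom1 N f ≡ Σ< (suc N) f
sumFrom1≡Σ< zero    f f0≡0 = trans (sym f0≡0) (sym (+-identityʳ (f 0)))
sumFrom1≡Σ< (suc N) f f0≡0 = trans (cong (_+ f (suc N)) (sumFrom1≡Σ< N f f0≡0)) (sym (Σ<-snoc (suc N) f))

G≡Σ< : ∀ K → 0 < K → G (2 * K + 1) ≡ Σ< (2 * K + 1) (λ j → j ^ K)
G≡Σ< K@(suc _) _ = begin
  G (2 * K + 1)                                        ≡⟨ cong (λ N → sumFrom1 N (λ j → j ^ (N / 2))) (m+n∸n≡m (2 * K) 1) ⟩
  sumFrom1 (2 * K) (λ j → j ^ ((2 * K) / 2))           ≡⟨ cong (λ e → sumFrom1 (2 * K) (λ j → j ^ e)) [2K]/2≡K ⟩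
  sumFrom1 (2 * K) (λ j → j ^ K)                       ≡⟨ sumFrom1≡Σ< (2 * K) (λ j → j ^ K) refl ⟩
  Σ< (suc (2 * K)) (λ j → j ^ K)                       ≡⟨ cong (λ n → Σ< n (λ j → j ^ K)) (+-comm 1 (2 * K)) ⟩
  Σ< (2 * K + 1) (λ j → j ^ K)                         ∎
  where
  open ≡-Reasoning
  [2K]/2≡K : (2 * K) / 2 ≡ K
  [2K]/2≡K = trans (cong (_/ 2) (*-comm 2 K)) (m*n/n≡m K 2)

-- Criterion for 𝔓: n = 2 ^ m + 1 (m > 0) lies in 𝔓 if no prime divisor p of n
-- has p ∸ 1 dividing K = 2 ^ (m ∸ 1) = (n ∸ 1) / 2. For each prime power
-- q = p ^ a dividing n, non-root supplies a unit c mod p with p ∤ c ^ K ∸ 1;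
-- then c is a unit mod q and c ^ K ∸ 1 is coprime to q, so q divides the power
-- sum, and the prime powers assemble to n ∣ G n.
𝔓-criterion : ∀ m → 0 < m → (∀ p → Prime p → p ∣ 2 ^ m + 1 → ¬ (p ∸ 1) ∣ 2 ^ (m ∸ 1)) →
              InP (2 ^ m + 1)
𝔓-criterion (suc J) _ no-bad-prime = (K , refl) , subst (n ∣_) (sym (G≡Σ< K (m^n>0 2 J))) n∣S
  where
  K = 2 ^ J
  n = 2 ^ suc J + 1
  S = Σ< n (λ j → j ^ K)
  prime-power∣S : ∀ p a → Prime p → p ^ a ∣ n → p ^ a ∣ S
  prime-power∣S p zero    _  _    = 1∣ S
  prime-power∣S p (suc a) pp pᵃ∣n with non-root pp J (no-bad-prime p pp (∣-trans (m∣m*n (p ^ a)) pᵃ∣n))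
    where instance _ = prime⇒nonZero pp
  ... | c , p∤c , p∤cᴷ∸1 = power-sum-vanishes q n K pᵃ∣n (proj₂ c⁻¹) (^-positive K (∤⇒>0 p∤c)) q⊥cᴷ∸1
    where
    q = p ^ suc a
    instance _ = m^n≢0 p (suc a) {{prime⇒nonZero pp}}
    c⁻¹ = inverse q c (coprime-^ (suc a) (Coprime.sym (prime∤⇒coprime pp p∤c)))
    q⊥cᴷ∸1 = Coprime.sym (coprime-^ (suc a) (Coprime.sym (prime∤⇒coprime pp p∤cᴷ∸1)))
  n∣S : n ∣ S
  n∣S = prime-powers⇒∣ (subst (0 <_) (+-comm 1 (2 ^ suc J)) z<s) prime-power∣S

mainTheorem9 : (α m₁ : ℕ) → Odd m₁ → 1 < m₁ →
    ¬ Prime (2 ^ (2 ^ α) + 1) →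
    InP (2 ^ (2 ^ α * m₁) + 1)
mainTheorem9 α m₁ (k , m₁≡2k+1) _ F-not-prime =
  subst (λ x → InP (2 ^ (2 ^ α * x) + 1)) (sym m₁≡1+2k) (𝔓-criterion m (2^α*odd>0 α k) no-bad-prime)
  where
  m = 2 ^ α * suc (2 * k)
  m₁≡1+2k : m₁ ≡ suc (2 * k)
  m₁≡1+2k = trans m₁≡2k+1 (+-comm (2 * k) 1)
  no-bad-prime : ∀ p → Prime p → p ∣ 2 ^ m + 1 → ¬ (p ∸ 1) ∣ 2 ^ (m ∸ 1)
  no-bad-prime p pp p∣2ᵐ+1 p-1∣2ᵐ⁻¹ =
    F-not-prime (subst Prime (fermat-divisor α k (m ∸ 1) pp p∣2ᵐ+1 p-1∣2ᵐ⁻¹) pp)
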